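{- For a subset $U\subseteq\mathcal{B}$, $U$ is avoidable if and only if $U^*=\{s^*\mid s\in U\}$ is avoidable. Furthermore, $U$ is maximal avoidable if and only if $U^*$ is maximal avoidable.
   Context: The bicyclic inverse semigroup is $\mathcal{B}=\{(a,b)\in\mathbb{Z}\times\mathbb{Z}\mid a\ge 0,\ a+b\ge 0\}$ with multiplication $(a,b)(c,d)=(\max\{c+d,a\}-d,\ b+d)$ and inverse $(a,b)^*=(a+b,-b)$. A subset $U\subseteq\mathcal{B}$ is avoidable if $\mathcal{B}$ can be partitioned into two sets $A$ and $B$ such that no element of $U$ is a product $st$ of two distinct elements $s\ne t$ both in $A$ or both in $B$. $U$ is maximal avoidable if it is avoidable and not properly contained in any avoidable subset of $\mathcal{B}$. -}

module Defs where

open import Data.Integer using (ℤ; +_; _+_; _-_; -_; _≤_; _⊔_)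
open import Data.Bool using (Bool)
open import Data.Product using (Σ; _×_; _,_; ∃)
open import Relation.Binary.PropositionalEquality using (_≡_)
open import Relation.Nullary using (¬_)
open import Level using (Level) renaming (suc to lsuc; zero to lzero)

-- The bicyclic inverse semigroup  B = {(a,b) ∈ ℤ×ℤ | a ≥ 0, a + b ≥ 0}.
record 𝓑 : Set where
  constructor ⟨_,_∣_,_⟩
  field
    fst   : ℤ
    snd   : ℤ
    fst≥0 : + 0 ≤ fst
    sum≥0 : + 0 ≤ fst + snd
open 𝓑 public

-- Equality of elements of B: equality of both coordinates
-- (the membership proofs carry no information).
_≈_ : 𝓑 → 𝓑 → Set
s ≈ t = (fst s ≡ fst t) × (snd s ≡ snd t)

-- Coordinates of the product (a,b)(c,d) = (max{c+d,a} - d, b + d).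
mul₁ : 𝓑 → 𝓑 → ℤ
mul₁ s t = ((fst t + snd t) ⊔ fst s) - snd t

mul₂ : 𝓑 → 𝓑 → ℤ
mul₂ s t = snd s + snd t

IsProduct : 𝓑 → 𝓑 → 𝓑 → Set
IsProduct s t u = (mul₁ s t ≡ fst u) × (mul₂ s t ≡ snd u)

inv₁ : 𝓑 → ℤ
inv₁ s = fst s + snd s

inv₂ : 𝓑 → ℤ
inv₂ s = - snd s

IsInverse : 𝓑 → 𝓑 → Set
IsInverse s t = (inv₁ s ≡ fst t) × (inv₂ s ≡ snd t)

Subset : Set₁
Subset = 𝓑 → Set

_⊆_ : Subset → Subset → Set
U ⊆ V = ∀ x → U x → V x

_* : Subset → Subset
(U *) x = Σ 𝓑 λ s → U s × IsInverse s x

-- A partition of B into two sets A, B is given by a colouring B → Bool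
-- (A = colour true, B = colour false).
Avoidable : Subset → Set
Avoidable U = Σ (𝓑 → Bool) λ c →
  ∀ s t u → ¬ (s ≈ t) → c s ≡ c t → U u → ¬ IsProduct s t u

MaximalAvoidable : Subset → Set₁
MaximalAvoidable U = Avoidable U × (∀ V → Avoidable V → U ⊆ V → V ⊆ U)

-- Inversion `inv` is an involution of B (s** = s) and an
-- anti-automorphism ((st)* = t* s*).  So if a colouring c of B witnesses
-- that U is avoidable, the colouring c ∘ inv witnesses that U* is: a
-- monochromatic product s t = u of distinct elements with u ∈ U* gives a
-- monochromatic product t* s* = u* of distinct elements with u* ∈ U.
module Submission where

open import Defs
open import Data.Product using (_×_; _,_)
open import Function.Bundles using (_⇔_; mk⇔)
open import Data.Integer using (ℤ; +_; _+_; _-_; -_; _≤_; _⊔_)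
open import Data.Integer.Properties using (≤-irrelevant; ⊔-comm)
open import Data.Integer.Tactic.RingSolver using (solve-∀)
open import Relation.Binary.PropositionalEquality
  using (_≡_; refl; sym; trans; cong; cong₂; subst; module ≡-Reasoning)
open import Relation.Nullary using (¬_)

-- Elements of B are determined by their coordinates, since the
-- non-negativity proofs are propositions.
≈⇒≡ : ∀ {s t} → s ≈ t → s ≡ t
≈⇒≡ {⟨ a , b ∣ p , q ⟩} {⟨ .a , .b ∣ p′ , q′ ⟩} (refl , refl)
  rewrite ≤-irrelevant p p′ | ≤-irrelevant q q′ = refl

≡⇒≈ : ∀ {s t} → s ≡ t → s ≈ t
≡⇒≈ refl = refl , refl

add-sub-cancel : ∀ (a b : ℤ) → (a + b) + (- b) ≡ a
add-sub-cancel = solve-∀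

neg-involutive : ∀ (b : ℤ) → - - b ≡ b
neg-involutive = solve-∀

-- The inverse (a,b)* = (a+b, -b), as an element of B: its first coordinate
-- a+b is non-negative, and so is the sum of its coordinates, which is a.
inv : 𝓑 → 𝓑
inv s = record
  { fst   = fst s + snd s
  ; snd   = - snd s
  ; fst≥0 = sum≥0 s
  ; sum≥0 = subst (+ 0 ≤_) (sym (add-sub-cancel (fst s) (snd s))) (fst≥0 s)
  }

isInverse⇒≡ : ∀ {s t} → IsInverse s t → inv s ≡ t
isInverse⇒≡ = ≈⇒≡

inv-involutive : ∀ s → inv (inv s) ≡ s
inv-involutive s = ≈⇒≡ (add-sub-cancel (fst s) (snd s) , neg-involutive (snd s))

inv-injective : ∀ {s t} → inv s ≡ inv t → s ≡ t
inv-injective {s} {t} eq = begin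
  s             ≡⟨ sym (inv-involutive s) ⟩
  inv (inv s)   ≡⟨ cong inv eq ⟩
  inv (inv t)   ≡⟨ inv-involutive t ⟩
  t             ∎
  where open ≡-Reasoning

*-elim : ∀ {U} x → (U *) x → U (inv x)
*-elim {U} x (s , s∈U , s*≡x) =
  subst U (trans (sym (inv-involutive s)) (cong inv (isInverse⇒≡ {s} s*≡x))) s∈U

*-intro : ∀ {U} x → U (inv x) → (U *) x
*-intro x x*∈U = inv x , x*∈U , ≡⇒≈ {inv (inv x)} (inv-involutive x)

**-⊆ : ∀ U → ((U *) *) ⊆ U
**-⊆ U x x∈U** = subst U (inv-involutive x) (*-elim {U} (inv x) (*-elim {U *} x x∈U**))

⊆-** : ∀ U → U ⊆ ((U *) *)
⊆-** U x x∈U = *-intro {U *} x (*-intro {U} (inv x) (subst U (sym (inv-involutive x)) x∈U))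

*-mono : ∀ {U V} → U ⊆ V → (U *) ⊆ (V *)
*-mono U⊆V x (s , s∈U , s*≡x) = s , U⊆V s s∈U , s*≡x

-- Writing s = (a,b), t = (c,d): the second coordinate of t* s* is
-- -d - b = -(b+d), and its first is max{a, c+d} + b, which equals
-- (max{c+d, a} - d) + (b + d), the sum of the coordinates of s t.
inv-antihom : ∀ {s t u} → IsProduct s t u → IsProduct (inv t) (inv s) (inv u)
inv-antihom {s} {t} {u} (st₁ , st₂) = first , second
  where
  a = fst s ; b = snd s ; c = fst t ; d = snd t

  regroup : ∀ (m d b : ℤ) → m - (- b) ≡ (m - d) + (b + d)
  regroup = solve-∀

  neg-distrib : ∀ (b d : ℤ) → (- d) + (- b) ≡ - (b + d)
  neg-distrib = solve-∀

  first : mul₁ (inv t) (inv s) ≡ fst u + snd u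
  first = begin
    ((a + b) + (- b) ⊔ (c + d)) - (- b) ≡⟨ cong (λ m → (m ⊔ (c + d)) - (- b)) (add-sub-cancel a b) ⟩
    (a ⊔ (c + d)) - (- b)               ≡⟨ cong (_- (- b)) (⊔-comm a (c + d)) ⟩
    ((c + d) ⊔ a) - (- b)               ≡⟨ regroup ((c + d) ⊔ a) d b ⟩
    mul₁ s t + mul₂ s t                 ≡⟨ cong₂ _+_ st₁ st₂ ⟩
    fst u + snd u                       ∎
    where open ≡-Reasoning

  second : mul₂ (inv t) (inv s) ≡ - snd u
  second = trans (neg-distrib b d) (cong -_ st₂)

inv-distinct : ∀ {s t} → ¬ (s ≈ t) → ¬ (inv t ≈ inv s)
inv-distinct {s} {t} s≉t t*≈s* = s≉t (≡⇒≈ (sym (inv-injective {t} {s} (≈⇒≡ {inv t} t*≈s*))))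

avoidable-* : ∀ {U} → Avoidable U → Avoidable (U *)
avoidable-* {U} (c , avoids) = (λ x → c (inv x)) , avoids*
  where
  avoids* : ∀ s t u → ¬ (s ≈ t) → c (inv s) ≡ c (inv t) → (U *) u →
            ¬ IsProduct s t u
  avoids* s t u s≉t same u∈U* st≡u =
    avoids (inv t) (inv s) (inv u) (inv-distinct {s} {t} s≉t) (sym same)
           (*-elim {U} u u∈U*) (inv-antihom {s} {t} {u} st≡u)

avoidable-antitone : ∀ {U V} → V ⊆ U → Avoidable U → Avoidable V
avoidable-antitone V⊆U (c , avoids) =
  c , λ s t u s≉t same u∈V → avoids s t u s≉t same (V⊆U u u∈V)

maximal-respects : ∀ {U V} → U ⊆ V → V ⊆ U →
                   MaximalAvoidable U → MaximalAvoidable V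
maximal-respects U⊆V V⊆U (avU , maxU) =
  avoidable-antitone V⊆U avU ,
  λ W avW V⊆W x x∈W → U⊆V x (maxU W avW (λ y y∈U → V⊆W y (U⊆V y y∈U)) x x∈W)

-- If U is maximal avoidable then so is U*: an avoidable W ⊇ U* gives an
-- avoidable W* ⊇ U** ⊇ U, so W* ⊆ U by maximality and W ⊆ W** ⊆ U*.
maximal-* : ∀ {U} → MaximalAvoidable U → MaximalAvoidable (U *)
maximal-* {U} (avU , maxU) = avoidable-* avU , maximal
  where
  maximal : ∀ W → Avoidable W → (U *) ⊆ W → W ⊆ (U *)
  maximal W avW U*⊆W x x∈W =
    *-mono W*⊆U x (⊆-** W x x∈W)
    where
    U⊆W* : U ⊆ (W *)
    U⊆W* y y∈U = *-mono U*⊆W y (⊆-** U y y∈U)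

    W*⊆U : (W *) ⊆ U
    W*⊆U = maxU (W *) (avoidable-* avW) U⊆W*

mainTheorem10 : (U : Subset) →
    (Avoidable U ⇔ Avoidable (U *)) × (MaximalAvoidable U ⇔ MaximalAvoidable (U *))
mainTheorem10 U =
  mk⇔ avoidable-*
      (λ avU* → avoidable-antitone (⊆-** U) (avoidable-* avU*)) ,
  mk⇔ maximal-*
      (λ maxU* → maximal-respects (**-⊆ U) (⊆-** U) (maximal-* maxU*))
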